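{- Let $m,n$ be nonnegative integers. Then $$\sum_{k=0}^n\binom mk(-4)^k\binom{2(n-k)}{n-k}=4^n\prod_{k=1}^n\left(1-\frac{2m+1}{2k}\right).$$ -}

module Defs where

open import Data.Nat using (ℕ; zero; suc)
open import Data.Rational using (ℚ; 0ℚ; 1ℚ; _+_; _*_)

_^ℚ_ : ℚ → ℕ → ℚ
q ^ℚ zero = 1ℚ
q ^ℚ suc n = q * (q ^ℚ n)

-- sumTo n f = f 0 + f 1 + ... + f n   (i.e. sum_{k=0}^{n} f k)
sumTo : ℕ → (ℕ → ℚ) → ℚ
sumTo zero f = f zero
sumTo (suc n) f = sumTo n f + f (suc n)

-- prodBelow n g = g 0 * g 1 * ... * g (n-1)   (empty product = 1)
prodBelow : ℕ → (ℕ → ℚ) → ℚ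
prodBelow zero g = 1ℚ
prodBelow (suc n) g = prodBelow n g * g n

module Submission where

-- Both satisfy the Pascal-type recurrence
--     F(m+1, n+1) = F(m, n+1) - 4 F(m, n),
-- agree on the boundary row m = 0 (where both equal the central binomial
-- coefficient C(2n,n)) and on the boundary column n = 0 (where both are 1);
-- such a family is determined by its boundary values (pascal-unique).
--
-- For the sum,
-- the recurrence comes from Pascal's rule inside a general binomial transform.
-- For the product, 4^n ∏ (1 - (2m+1)/(2k)) is a product of factors
-- c(m,j) = 4 - 2(2m+1)/(j+1); after clearing the denominator j+1 these are
-- linear polynomials, which gives the two factor identities that drive a
-- general recurrence for partial products.

open import Defs
open import Data.Nat as ℕ using (ℕ; suc; zero; _∸_)
open import Data.Nat.Combinatorics using (_C_; nCk+nC[k+1]≡[n+1]C[k+1]; nC1≡n; nCk≡nC[n∸k])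
import Data.Nat.Properties as ℕP
import Data.Nat.Tactic.RingSolver as ℕRing
open import Data.Integer as ℤ using (+_; -[1+_])
import Data.Integer.Properties as ℤP
import Data.Integer.Tactic.RingSolver as ℤRing
open import Data.Rational using (ℚ; _/_; _*_; _-_; _+_; -_; 1ℚ; 0ℚ; NonZero; 1/_; fromℚᵘ)
open import Data.Rational.Properties
  using (+-*-commutativeRing; _≟_; toℚᵘ-injective; toℚᵘ-fromℚᵘ; fromℚᵘ-cong; toℚᵘ-homo-+; toℚᵘ-homo-*;
         normalize-pos; pos⇒nonZero; *-inverseˡ; *-identityˡ; *-assoc; *-zeroˡ; +-assoc; +-identityʳ;
         *-distribˡ-+)
import Data.Rational.Unnormalised as ℚᵘ
import Data.Rational.Unnormalised.Properties as ℚᵘP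
open import Level using (0ℓ)
open import Relation.Nullary.Decidable using (dec⇒maybe)
open import Tactic.RingSolver using (solve-∀)
open import Tactic.RingSolver.Core.AlmostCommutativeRing using (AlmostCommutativeRing; fromCommutativeRing)
open import Relation.Binary.PropositionalEquality using (_≡_; refl; sym; trans; cong; cong₂; module ≡-Reasoning)
open ≡-Reasoning

ℚ-ring : AlmostCommutativeRing 0ℓ 0ℓ
ℚ-ring = fromCommutativeRing +-*-commutativeRing (λ q → dec⇒maybe (0ℚ ≟ q))

pascal-unique : {A : Set} (step : A → A → A) (F G : ℕ → ℕ → A) →
  (∀ m n → F (suc m) (suc n) ≡ step (F m (suc n)) (F m n)) →
  (∀ m n → G (suc m) (suc n) ≡ step (G m (suc n)) (G m n)) →
  (∀ n → F 0 n ≡ G 0 n) → (∀ m → F m 0 ≡ G m 0) →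
  ∀ m n → F m n ≡ G m n
pascal-unique step F G F-rec G-rec row col = go
  where
  go : ∀ m n → F m n ≡ G m n
  go zero n = row n
  go (suc m) zero = col (suc m)
  go (suc m) (suc n) = trans (F-rec m n) (trans (cong₂ step (go m (suc n)) (go m n)) (sym (G-rec m n)))

ι : ℕ → ℚ
ι k = + k / 1

fromℚᵘ-homo-+ : ∀ p q → fromℚᵘ (p ℚᵘ.+ q) ≡ fromℚᵘ p + fromℚᵘ q
fromℚᵘ-homo-+ p q = toℚᵘ-injective (ℚᵘP.≃-trans (toℚᵘ-fromℚᵘ (p ℚᵘ.+ q)) (ℚᵘP.≃-sym
  (ℚᵘP.≃-trans (toℚᵘ-homo-+ (fromℚᵘ p) (fromℚᵘ q)) (ℚᵘP.+-cong (toℚᵘ-fromℚᵘ p) (toℚᵘ-fromℚᵘ q)))))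

fromℚᵘ-homo-* : ∀ p q → fromℚᵘ (p ℚᵘ.* q) ≡ fromℚᵘ p * fromℚᵘ q
fromℚᵘ-homo-* p q = toℚᵘ-injective (ℚᵘP.≃-trans (toℚᵘ-fromℚᵘ (p ℚᵘ.* q)) (ℚᵘP.≃-sym
  (ℚᵘP.≃-trans (toℚᵘ-homo-* (fromℚᵘ p) (fromℚᵘ q)) (ℚᵘP.*-cong (toℚᵘ-fromℚᵘ p) (toℚᵘ-fromℚᵘ q)))))

ι-+ : ∀ a b → ι (a ℕ.+ b) ≡ ι a + ι b
ι-+ a b = trans (fromℚᵘ-cong {+ (a ℕ.+ b) ℚᵘ./ 1} {(+ a ℚᵘ./ 1) ℚᵘ.+ (+ b ℚᵘ./ 1)} (ℚᵘ.*≡* cross))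
                (fromℚᵘ-homo-+ (+ a ℚᵘ./ 1) (+ b ℚᵘ./ 1))
  where
  sum-over-1 : ∀ x y → (x ℤ.+ y) ℤ.* (+ 1 ℤ.* + 1) ≡ (x ℤ.* + 1 ℤ.+ y ℤ.* + 1) ℤ.* + 1
  sum-over-1 = ℤRing.solve-∀
  cross : + (a ℕ.+ b) ℤ.* (+ 1 ℤ.* + 1) ≡ (+ a ℤ.* + 1 ℤ.+ + b ℤ.* + 1) ℤ.* + 1
  cross = trans (cong (ℤ._* (+ 1 ℤ.* + 1)) (ℤP.pos-+ a b)) (sum-over-1 (+ a) (+ b))

ι-* : ∀ a b → ι (a ℕ.* b) ≡ ι a * ι b
ι-* a b = trans (fromℚᵘ-cong {+ (a ℕ.* b) ℚᵘ./ 1} {(+ a ℚᵘ./ 1) ℚᵘ.* (+ b ℚᵘ./ 1)}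
                             (ℚᵘ.*≡* (cong (ℤ._* + 1) (ℤP.pos-* a b))))
                (fromℚᵘ-homo-* (+ a ℚᵘ./ 1) (+ b ℚᵘ./ 1))

ι-suc : ∀ a → ι (suc a) ≡ 1ℚ + ι a
ι-suc = ι-+ 1

ι-odd : ∀ m → ι (suc (m ℕ.+ m)) ≡ 1ℚ + (ι m + ι m)
ι-odd m = trans (ι-suc (m ℕ.+ m)) (cong (λ z → 1ℚ + z) (ι-+ m m))

ι-*-/ : ∀ p d → ι (suc d) * (p / suc d) ≡ p / 1
ι-*-/ p d = trans (sym (fromℚᵘ-homo-* (+ suc d ℚᵘ./ 1) (p ℚᵘ./ suc d)))
                  (fromℚᵘ-cong {(+ suc d ℚᵘ./ 1) ℚᵘ.* (p ℚᵘ./ suc d)} {p ℚᵘ./ 1} (ℚᵘ.*≡* (cancel (+ suc d) p)))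
  where
  cancel : ∀ x y → (x ℤ.* y) ℤ.* + 1 ≡ y ℤ.* (+ 1 ℤ.* x)
  cancel = ℤRing.solve-∀

*-cancelˡ : ∀ q .{{_ : NonZero q}} {x y} → q * x ≡ q * y → x ≡ y
*-cancelˡ q {x} {y} qx≡qy = trans (unscale x) (trans (cong (1/ q *_) qx≡qy) (sym (unscale y)))
  where
  unscale : ∀ z → z ≡ 1/ q * (q * z)
  unscale z = trans (sym (*-identityˡ z)) (trans (cong (_* z) (sym (*-inverseˡ q))) (*-assoc (1/ q) q z))

ι-suc-cancelˡ : ∀ j {x y} → ι (suc j) * x ≡ ι (suc j) * y → x ≡ y
ι-suc-cancelˡ j = *-cancelˡ (ι (suc j)) {{pos⇒nonZero (ι (suc j)) {{normalize-pos (suc j) 1}}}}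

sumTo-shift : ∀ n f → sumTo (suc n) f ≡ f 0 + sumTo n (λ k → f (suc k))
sumTo-shift zero f = refl
sumTo-shift (suc n) f = trans (cong (_+ f (suc (suc n))) (sumTo-shift n f)) (+-assoc (f 0) _ _)

sumTo-cong : ∀ n {f g : ℕ → ℚ} → (∀ k → f k ≡ g k) → sumTo n f ≡ sumTo n g
sumTo-cong zero f≡g = f≡g 0
sumTo-cong (suc n) f≡g = cong₂ _+_ (sumTo-cong n f≡g) (f≡g (suc n))

sumTo-vanish : ∀ n {f : ℕ → ℚ} → (∀ k → f k ≡ 0ℚ) → sumTo n f ≡ 0ℚ
sumTo-vanish zero f≡0 = f≡0 0
sumTo-vanish (suc n) f≡0 = cong₂ _+_ (sumTo-vanish n f≡0) (f≡0 (suc n))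

sumTo-+ : ∀ n f g → sumTo n (λ k → f k + g k) ≡ sumTo n f + sumTo n g
sumTo-+ zero f g = refl
sumTo-+ (suc n) f g = trans (cong (_+ (f (suc n) + g (suc n))) (sumTo-+ n f g))
                            (interchange (sumTo n f) (sumTo n g) (f (suc n)) (g (suc n)))
  where
  interchange : ∀ a b c d → (a + b) + (c + d) ≡ (a + c) + (b + d)
  interchange = solve-∀ ℚ-ring

sumTo-* : ∀ n x f → sumTo n (λ k → x * f k) ≡ x * sumTo n f
sumTo-* zero x f = refl
sumTo-* (suc n) x f = trans (cong (_+ x * f (suc n)) (sumTo-* n x f)) (sym (*-distribˡ-+ x (sumTo n f) (f (suc n))))

^ℚ-prodBelow : ∀ x g n → (x ^ℚ n) * prodBelow n g ≡ prodBelow n (λ j → x * g j)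
^ℚ-prodBelow x g zero = refl
^ℚ-prodBelow x g (suc n) = begin
    (x * x ^ℚ n) * (prodBelow n g * g n)   ≡⟨ regroup x (x ^ℚ n) (prodBelow n g) (g n) ⟩
    (x ^ℚ n * prodBelow n g) * (x * g n)   ≡⟨ cong (_* (x * g n)) (^ℚ-prodBelow x g n) ⟩
    prodBelow n (λ j → x * g j) * (x * g n) ∎
  where
  regroup : ∀ a b c d → (a * b) * (c * d) ≡ (b * c) * (a * d)
  regroup = solve-∀ ℚ-ring

prodBelow-pascal : ∀ x (g h : ℕ → ℚ) → h 0 ≡ g 0 + x →
  (∀ n → (g n + x) * h (suc n) ≡ g n * (g (suc n) + x)) →
  ∀ n → prodBelow (suc n) h ≡ prodBelow (suc n) g + x * prodBelow n g
prodBelow-pascal x g h h₀ h-step zero = begin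
    1ℚ * h 0          ≡⟨ cong (1ℚ *_) h₀ ⟩
    1ℚ * (g 0 + x)    ≡⟨ expand (g 0) x ⟩
    1ℚ * g 0 + x * 1ℚ ∎
  where
  expand : ∀ a y → 1ℚ * (a + y) ≡ 1ℚ * a + y * 1ℚ
  expand = solve-∀ ℚ-ring
prodBelow-pascal x g h h₀ h-step (suc n) = begin
    prodBelow (suc n) h * h (suc n)                 ≡⟨ cong (_* h (suc n)) (prodBelow-pascal x g h h₀ h-step n) ⟩
    (p * g n + x * p) * h (suc n)                   ≡⟨ factor-left x p (g n) (h (suc n)) ⟩
    p * ((g n + x) * h (suc n))                     ≡⟨ cong (p *_) (h-step n) ⟩
    p * (g n * (g (suc n) + x))                     ≡⟨ factor-right x p (g n) (g (suc n)) ⟩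
    (p * g n) * g (suc n) + x * (p * g n)           ∎
  where
  p = prodBelow n g
  factor-left : ∀ y a b c → (a * b + y * a) * c ≡ a * ((b + y) * c)
  factor-left = solve-∀ ℚ-ring
  factor-right : ∀ y a b c → a * (b * (c + y)) ≡ (a * b) * c + y * (a * b)
  factor-right = solve-∀ ℚ-ring

binomialSum : (ℕ → ℕ → ℚ) → ℕ → ℕ → ℚ
binomialSum u m n = sumTo n (λ k → ι (m C k) * u n k)

binomialSum-row0 : ∀ u n → binomialSum u 0 n ≡ u n 0
binomialSum-row0 u zero = *-identityˡ (u 0 0)
binomialSum-row0 u (suc n) = begin
    binomialSum u 0 (suc n)                                  ≡⟨ sumTo-shift n _ ⟩
    1ℚ * u (suc n) 0 + sumTo n (λ k → 0ℚ * u (suc n) (suc k)) ≡⟨ cong₂ _+_ (*-identityˡ (u (suc n) 0)) (sumTo-vanish n (λ k → *-zeroˡ (u (suc n) (suc k)))) ⟩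
    u (suc n) 0 + 0ℚ                                         ≡⟨ +-identityʳ _ ⟩
    u (suc n) 0                                              ∎

-- If shifting both indices of u multiplies it by x, then Pascal's rule
-- C(m+1,k+1) = C(m,k) + C(m,k+1) turns into a recurrence for the transform.
binomialSum-pascal : ∀ x u → (∀ n k → u (suc n) (suc k) ≡ x * u n k) →
  ∀ m n → binomialSum u (suc m) (suc n) ≡ binomialSum u m (suc n) + x * binomialSum u m n
binomialSum-pascal x u u-shift m n = begin
    binomialSum u (suc m) (suc n)                             ≡⟨ sumTo-shift n _ ⟩
    u₀ + sumTo n (λ k → ι (suc m C suc k) * u (suc n) (suc k)) ≡⟨ cong (_+_ u₀) (sumTo-cong n pascal-term) ⟩
    u₀ + sumTo n (λ k → v k + x * w k)                          ≡⟨ cong (_+_ u₀) (trans (sumTo-+ n v _) (cong (_+_ (sumTo n v)) (sumTo-* n x w))) ⟩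
    u₀ + (sumTo n v + x * binomialSum u m n)                    ≡⟨ sym (+-assoc u₀ _ _) ⟩
    (u₀ + sumTo n v) + x * binomialSum u m n                    ≡⟨ cong (_+ x * binomialSum u m n) (sym (sumTo-shift n _)) ⟩
    binomialSum u m (suc n) + x * binomialSum u m n             ∎
  where
  u₀ = 1ℚ * u (suc n) 0
  v : ℕ → ℚ
  v k = ι (m C suc k) * u (suc n) (suc k)
  w : ℕ → ℚ
  w k = ι (m C k) * u n k
  split : ∀ y a b c → (a + b) * (y * c) ≡ b * (y * c) + y * (a * c)
  split = solve-∀ ℚ-ring
  pascal-term : ∀ k → ι (suc m C suc k) * u (suc n) (suc k) ≡ v k + x * w k
  pascal-term k = begin
      ι (suc m C suc k) * u (suc n) (suc k)               ≡⟨ cong (λ c → ι c * u (suc n) (suc k)) (sym (nCk+nC[k+1]≡[n+1]C[k+1] m k)) ⟩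
      ι (m C k ℕ.+ m C suc k) * u (suc n) (suc k)         ≡⟨ cong₂ _*_ (ι-+ (m C k) (m C suc k)) (u-shift n k) ⟩
      (ι (m C k) + ι (m C suc k)) * (x * u n k)           ≡⟨ split x (ι (m C k)) (ι (m C suc k)) (u n k) ⟩
      ι (m C suc k) * (x * u n k) + x * w k               ≡⟨ cong (λ t → ι (m C suc k) * t + x * w k) (sym (u-shift n k)) ⟩
      v k + x * w k                                       ∎

absorption : ∀ n k → suc k ℕ.* (suc n C suc k) ≡ suc n ℕ.* (n C k)
absorption zero zero = refl
absorption zero (suc k) = ℕP.*-zeroʳ (suc (suc k))
absorption (suc n) zero = trans (ℕP.*-identityˡ _) (trans (nC1≡n (suc (suc n))) (sym (ℕP.*-identityʳ (suc (suc n)))))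
absorption (suc n) (suc k) = begin
    (2 ℕ.+ k) ℕ.* (suc (suc n) C suc (suc k))     ≡⟨ cong ((2 ℕ.+ k) ℕ.*_) (sym (nCk+nC[k+1]≡[n+1]C[k+1] (suc n) (suc k))) ⟩
    (2 ℕ.+ k) ℕ.* (X ℕ.+ Y)                       ≡⟨ spread k X Y ⟩
    (1 ℕ.+ k) ℕ.* X ℕ.+ X ℕ.+ (2 ℕ.+ k) ℕ.* Y     ≡⟨ cong₂ ℕ._+_ (cong₂ ℕ._+_ (absorption n k) (sym (nCk+nC[k+1]≡[n+1]C[k+1] n k)))
                                                                   (absorption n (suc k)) ⟩
    (1 ℕ.+ n) ℕ.* a ℕ.+ (a ℕ.+ b) ℕ.+ (1 ℕ.+ n) ℕ.* b ≡⟨ collect n a b ⟩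
    (2 ℕ.+ n) ℕ.* (a ℕ.+ b)                       ≡⟨ cong ((2 ℕ.+ n) ℕ.*_) (nCk+nC[k+1]≡[n+1]C[k+1] n k) ⟩
    (2 ℕ.+ n) ℕ.* X                               ∎
  where
  X = suc n C suc k
  Y = suc n C suc (suc k)
  a = n C k
  b = n C suc k
  spread : ∀ j x y → (2 ℕ.+ j) ℕ.* (x ℕ.+ y) ≡ (1 ℕ.+ j) ℕ.* x ℕ.+ x ℕ.+ (2 ℕ.+ j) ℕ.* y
  spread = ℕRing.solve-∀
  collect : ∀ j x y → (1 ℕ.+ j) ℕ.* x ℕ.+ (x ℕ.+ y) ℕ.+ (1 ℕ.+ j) ℕ.* y ≡ (2 ℕ.+ j) ℕ.* (x ℕ.+ y)
  collect = ℕRing.solve-∀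

centralBinomial : ℕ → ℕ
centralBinomial t = (t ℕ.+ t) C t

centralBinomial-step : ∀ n → suc n ℕ.* centralBinomial (suc n) ≡ 2 ℕ.* (suc (n ℕ.+ n) ℕ.* centralBinomial n)
centralBinomial-step n = begin
    suc n ℕ.* centralBinomial (suc n)               ≡⟨ cong (suc n ℕ.*_) (sym (nCk+nC[k+1]≡[n+1]C[k+1] A n)) ⟩
    suc n ℕ.* (A C n ℕ.+ A C suc n)                 ≡⟨ cong (λ c → suc n ℕ.* (c ℕ.+ A C suc n)) middle-symmetry ⟩
    suc n ℕ.* (A C suc n ℕ.+ A C suc n)             ≡⟨ double (suc n) (A C suc n) ⟩
    2 ℕ.* (suc n ℕ.* (A C suc n))                   ≡⟨ cong (λ t → 2 ℕ.* (suc n ℕ.* (t C suc n))) (ℕP.+-suc n n) ⟩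
    2 ℕ.* (suc n ℕ.* (suc (n ℕ.+ n) C suc n))       ≡⟨ cong (2 ℕ.*_) (absorption (n ℕ.+ n) n) ⟩
    2 ℕ.* (suc (n ℕ.+ n) ℕ.* centralBinomial n)     ∎
  where
  A = n ℕ.+ suc n
  middle-symmetry : A C n ≡ A C suc n
  middle-symmetry = trans (nCk≡nC[n∸k] (ℕP.m≤m+n n (suc n))) (cong (A C_) (ℕP.m+n∸m≡n n (suc n)))
  double : ∀ a b → a ℕ.* (b ℕ.+ b) ≡ 2 ℕ.* (a ℕ.* b)
  double = ℕRing.solve-∀

-- The j-th factor of 4^n ∏_{k=1}^{n} (1 - (2m+1)/(2k)), with k = j+1 and one
-- factor 4 of 4^n absorbed: c(m,j) = 4 (1 - (2m+1)/(2j+2)).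
factor : ℕ → ℕ → ℚ
factor m j = ι 4 * (1ℚ - (+ suc (m ℕ.+ m)) / (suc j ℕ.+ suc j))

-- The value of (j+1) c(m,j), as a polynomial in N = j+1 and y = m.
cleared : ℚ → ℚ → ℚ
cleared N y = ι 4 * N - ι 2 * (1ℚ + (y + y))

factor-cleared : ∀ m j → ι (suc j) * factor m j ≡ cleared (ι (suc j)) (ι m)
factor-cleared m j = begin
    N * (ι 4 * (1ℚ - Q))            ≡⟨ expand N Q ⟩
    ι 4 * N - ι 2 * ((N + N) * Q)   ≡⟨ cong (λ t → ι 4 * N - ι 2 * t) twice-N-Q ⟩
    cleared N (ι m)                 ∎
  where
  N = ι (suc j)
  Q = (+ suc (m ℕ.+ m)) / (suc j ℕ.+ suc j)
  expand : ∀ n q → n * (ι 4 * (1ℚ - q)) ≡ ι 4 * n - ι 2 * ((n + n) * q)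
  expand = solve-∀ ℚ-ring
  twice-N-Q : (N + N) * Q ≡ 1ℚ + (ι m + ι m)
  twice-N-Q = trans (cong (_* Q) (sym (ι-+ (suc j) (suc j)))) (trans (ι-*-/ (+ suc (m ℕ.+ m)) (j ℕ.+ suc j)) (ι-odd m))

factor-first : ∀ m → factor (suc m) 0 ≡ factor m 0 + (- ι 4)
factor-first m = begin
    factor (suc m) 0                ≡⟨ sym (*-identityˡ (factor (suc m) 0)) ⟩
    ι 1 * factor (suc m) 0          ≡⟨ factor-cleared (suc m) 0 ⟩
    cleared (ι 1) (ι (suc m))       ≡⟨ cong (cleared (ι 1)) (ι-suc m) ⟩
    cleared (ι 1) (1ℚ + ι m)        ≡⟨ lower (ι m) ⟩
    cleared (ι 1) (ι m) + (- ι 4)   ≡⟨ cong (_+ (- ι 4)) (sym (factor-cleared m 0)) ⟩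
    ι 1 * factor m 0 + (- ι 4)      ≡⟨ cong (_+ (- ι 4)) (*-identityˡ (factor m 0)) ⟩
    factor m 0 + (- ι 4)            ∎
  where
  lower : ∀ y → ι 4 * ι 1 - ι 2 * (1ℚ + ((1ℚ + y) + (1ℚ + y))) ≡ (ι 4 * ι 1 - ι 2 * (1ℚ + (y + y))) + (- ι 4)
  lower = solve-∀ ℚ-ring

-- Second factor identity: (c(m,n) - 4) c(m+1,n+1) = c(m,n) (c(m,n+1) - 4).
-- Multiplied by (n+1)(n+2) both sides become the same polynomial in n and m.
factor-step : ∀ m n → (factor m n + (- ι 4)) * factor (suc m) (suc n) ≡ factor m n * (factor m (suc n) + (- ι 4))
factor-step m n = ι-suc-cancelˡ n (ι-suc-cancelˡ (suc n) (begin
    N₁ * (N * ((a + (- ι 4)) * a'))                        ≡⟨ regroup-left N N₁ a a' ⟩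
    (N * a - ι 4 * N) * (N₁ * a')                          ≡⟨ cong₂ (λ s t → (s - ι 4 * N) * t) (factor-cleared m n) (factor-cleared (suc m) (suc n)) ⟩
    (cleared N y - ι 4 * N) * cleared N₁ (ι (suc m))       ≡⟨ cong₂ (λ s t → (cleared N y - ι 4 * N) * cleared s t) (ι-suc (suc n)) (ι-suc m) ⟩
    (cleared N y - ι 4 * N) * cleared (1ℚ + N) (1ℚ + y)    ≡⟨ cleared-identity N y ⟩
    cleared N y * (cleared (1ℚ + N) y - ι 4 * (1ℚ + N))    ≡⟨ cong (λ s → cleared N y * (cleared s y - ι 4 * s)) (sym (ι-suc (suc n))) ⟩
    cleared N y * (cleared N₁ y - ι 4 * N₁)                ≡⟨ cong₂ (λ s t → s * (t - ι 4 * N₁)) (sym (factor-cleared m n)) (sym (factor-cleared m (suc n))) ⟩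
    (N * a) * (N₁ * b - ι 4 * N₁)                          ≡⟨ regroup-right N N₁ a b ⟩
    N₁ * (N * (a * (b + (- ι 4))))                         ∎))
  where
  N = ι (suc n)
  N₁ = ι (suc (suc n))
  y = ι m
  a = factor m n
  a' = factor (suc m) (suc n)
  b = factor m (suc n)
  regroup-left : ∀ p p₁ s t → p₁ * (p * ((s + (- ι 4)) * t)) ≡ (p * s - ι 4 * p) * (p₁ * t)
  regroup-left = solve-∀ ℚ-ring
  regroup-right : ∀ p p₁ s t → (p * s) * (p₁ * t - ι 4 * p₁) ≡ p₁ * (p * (s * (t + (- ι 4))))
  regroup-right = solve-∀ ℚ-ring
  cleared-identity : ∀ p z → (ι 4 * p - ι 2 * (1ℚ + (z + z)) - ι 4 * p) * (ι 4 * (1ℚ + p) - ι 2 * (1ℚ + ((1ℚ + z) + (1ℚ + z))))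
                           ≡ (ι 4 * p - ι 2 * (1ℚ + (z + z))) * (ι 4 * (1ℚ + p) - ι 2 * (1ℚ + (z + z)) - ι 4 * (1ℚ + p))
  cleared-identity = solve-∀ ℚ-ring

centralBinomial-ratio : ∀ n → ι (centralBinomial (suc n)) ≡ ι (centralBinomial n) * factor 0 n
centralBinomial-ratio n = ι-suc-cancelˡ n (begin
    N * ι (centralBinomial (suc n))          ≡⟨ sym (ι-* (suc n) (centralBinomial (suc n))) ⟩
    ι (suc n ℕ.* centralBinomial (suc n))   ≡⟨ cong ι (centralBinomial-step n) ⟩
    ι (2 ℕ.* (suc (n ℕ.+ n) ℕ.* b))          ≡⟨ trans (ι-* 2 (suc (n ℕ.+ n) ℕ.* b)) (cong (ι 2 *_) (ι-* (suc (n ℕ.+ n)) b)) ⟩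
    ι 2 * (ι (suc (n ℕ.+ n)) * ι b)          ≡⟨ cong (λ t → ι 2 * (t * ι b)) (ι-odd n) ⟩
    ι 2 * ((1ℚ + (ι n + ι n)) * ι b)         ≡⟨ rearrange (ι n) (ι b) ⟩
    ι b * cleared (1ℚ + ι n) (ι 0)           ≡⟨ cong (λ t → ι b * cleared t (ι 0)) (sym (ι-suc n)) ⟩
    ι b * cleared N (ι 0)                    ≡⟨ cong (ι b *_) (sym (factor-cleared 0 n)) ⟩
    ι b * (N * factor 0 n)                   ≡⟨ swap (ι b) N (factor 0 n) ⟩
    N * (ι b * factor 0 n)                   ∎)
  where
  N = ι (suc n)
  b = centralBinomial n
  rearrange : ∀ x c → ι 2 * ((1ℚ + (x + x)) * c) ≡ c * (ι 4 * (1ℚ + x) - ι 2 * (1ℚ + (ι 0 + ι 0)))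
  rearrange = solve-∀ ℚ-ring
  swap : ∀ p q r → p * (q * r) ≡ q * (p * r)
  swap = solve-∀ ℚ-ring

-- The left-hand side: the binomial transform of (-4)^k C(2(n-k), n-k).
-- (The statement writes -4 as -[1+ 3 ] / 1, which is definitionally - ι 4.)
centralTerm : ℕ → ℕ → ℚ
centralTerm n k = ((- ι 4) ^ℚ k) * ι (centralBinomial (n ∸ k))

binomialSide : ℕ → ℕ → ℚ
binomialSide = binomialSum centralTerm

productSide : ℕ → ℕ → ℚ
productSide m n = prodBelow n (factor m)

productSide-row0 : ∀ n → productSide 0 n ≡ ι (centralBinomial n)
productSide-row0 zero = refl
productSide-row0 (suc n) = trans (cong (_* factor 0 n) (productSide-row0 n)) (sym (centralBinomial-ratio n))

productSide-pascal : ∀ m n → productSide (suc m) (suc n) ≡ productSide m (suc n) + (- ι 4) * productSide m n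
productSide-pascal m = prodBelow-pascal (- ι 4) (factor m) (factor (suc m)) (factor-first m) (factor-step m)

binomialSide-row0 : ∀ n → binomialSide 0 n ≡ ι (centralBinomial n)
binomialSide-row0 n = trans (binomialSum-row0 centralTerm n) (*-identityˡ (ι (centralBinomial n)))

binomialSide-pascal : ∀ m n → binomialSide (suc m) (suc n) ≡ binomialSide m (suc n) + (- ι 4) * binomialSide m n
binomialSide-pascal = binomialSum-pascal (- ι 4) centralTerm (λ n k → *-assoc (- ι 4) ((- ι 4) ^ℚ k) (ι (centralBinomial (n ∸ k))))

lemma3p3 : (m n : ℕ) →
    sumTo n (λ k → ((+ (m C k)) / 1) * ((((-[1+ 3 ]) / 1) ^ℚ k) * ((+ (((n ∸ k) ℕ.+ (n ∸ k)) C (n ∸ k))) / 1)))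
      ≡ ((+ 4 / 1) ^ℚ n) * prodBelow n (λ j → 1ℚ - ((+ (suc (m ℕ.+ m))) / (suc j ℕ.+ suc j)))
lemma3p3 m n = begin
    binomialSide m n  ≡⟨ pascal-unique (λ s t → s + (- ι 4) * t) binomialSide productSide
                           binomialSide-pascal productSide-pascal
                           (λ k → trans (binomialSide-row0 k) (sym (productSide-row0 k)))
                           (λ i → refl) m n ⟩
    productSide m n   ≡⟨ sym (^ℚ-prodBelow (ι 4) _ n) ⟩
    ((+ 4 / 1) ^ℚ n) * prodBelow n (λ j → 1ℚ - ((+ (suc (m ℕ.+ m))) / (suc j ℕ.+ suc j))) ∎
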